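{- For every $\varepsilon>0$ there is $\delta>0$ such that the following holds. Let $G=(V_1,V_2,E)$ be a bipartite graph with $|V_1|\ge|V_2|/2$ and let $\mathcal P=\{x_0,x_1,\ldots,x_{|V_2|^{0.5}}\}$ be an $\varepsilon$-pair-star of size $|V_2|^{0.5}$ rooted at $x_0$ and associated to $V_1$. If $W\subset V_2$ is chosen uniformly at random among all subsets of $V_2$, then $\mathbb P\big(|A^W_{\mathcal P}|\ge\delta|V_2|^{0.5}\big)\ge 3/4$, where $$A^W_{\mathcal P}=\{d^W(x_i)-d^W(x_0): i\in[|V_2|^{0.5}]\}\cap[-3|V_2|^{0.5},3|V_2|^{0.5}].$$
   Context: A bipartite graph $G=(V_1,V_2,E)$ has disjoint finite vertex classes and $E\subset V_1\times V_2$; $N(v)$ is the neighbourhood of $v$, $d(v)=|N(v)|$, $d^W(v)=|N(v)\cap W|$, and $\mathrm{div}(u,v)=N(u)\triangle N(v)$. An $\varepsilon$-pair-star of size $k$ rooted at $x_0$ associated to $V_1$ is a set $\{x_0,x_1,\ldots,x_k\}\subset V_1$ with $|d(x_j)-d(x_0)|\le|V_2|^{0.5}$ for all $j\in[k]$ and $|\mathrm{div}(x_i,x_j)|\ge\varepsilon|V_2|$ for all distinct $i,j\in\{0,\ldots,k\}$. Non-integer quantities such as $|V_2|^{0.5}$ used as sizes/indices are understood up to rounding.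
   Formalization: The parameter ε ranges over the positive rationals. -}

module Defs where

open import Data.Bool using (Bool; true; false; _∧_; _xor_; if_then_else_)
open import Data.Nat using (ℕ; zero; suc; _+_; _*_; _≤_)
open import Data.Fin using (Fin; zero; suc)
open import Data.Vec using (Vec; []; _∷_; lookup)
open import Data.List using (List; []; _∷_; map; _++_; length; filter; deduplicate; allFin)
open import Data.Integer as ℤ using (ℤ; +_; _-_; ∣_∣)
open import Data.Rational as ℚ using (ℚ; _/_)
open import Relation.Nullary using (¬_)
open import Relation.Binary.PropositionalEquality using (_≡_)
open import Function.Definitions using (Injective)
import Data.Nat.Properties as ℕP

BipGraph : ℕ → ℕ → Set
BipGraph n₁ n₂ = Fin n₁ → Fin n₂ → Bool

countB : {n : ℕ} → (Fin n → Bool) → ℕ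
countB {n} p = length (filter (λ j → p j Data.Bool.≟ true) (allFin n))

deg : {n₁ n₂ : ℕ} → BipGraph n₁ n₂ → Fin n₁ → ℕ
deg E v = countB (E v)

-- d^W(v) = |N(v) ∩ W|, with W ⊆ V₂ given as a characteristic vector
degW : {n₁ n₂ : ℕ} → BipGraph n₁ n₂ → Vec Bool n₂ → Fin n₁ → ℕ
degW E W v = countB (λ j → E v j ∧ lookup W j)

divSize : {n₁ n₂ : ℕ} → BipGraph n₁ n₂ → Fin n₁ → Fin n₁ → ℕ
divSize E u v = countB (λ j → E u j xor E v j)

ℕ→ℚ : ℕ → ℚ
ℕ→ℚ n = (+ n) / 1

-- ε-pair-star of size k rooted at x zero, associated to V₁:
-- an injective family x : Fin (suc k) → V₁ (the set {x₀,…,x_k}) with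
--   |d(x_j) - d(x₀)| ≤ r   for j ∈ [k]   (r = |V₂|^{0.5}, rounded), and
--   |div(x_i,x_j)| ≥ ε |V₂| for distinct i, j.
IsPairStar : {n₁ n₂ : ℕ} → BipGraph n₁ n₂ → ℚ → (r k : ℕ) → (Fin (suc k) → Fin n₁) → Set
IsPairStar {n₁} {n₂} E ε r k x =
  Injective _≡_ _≡_ x
  × (∀ (j : Fin k) → deg E (x (suc j)) ≤ deg E (x zero) + r × deg E (x zero) ≤ deg E (x (suc j)) + r)
  × (∀ (i j : Fin (suc k)) → ¬ (i ≡ j) → ε ℚ.* ℕ→ℚ n₂ ℚ.≤ ℕ→ℚ (divSize E (x i) (x j)))
  where open import Data.Product using (_×_)

AW : {n₁ n₂ : ℕ} → BipGraph n₁ n₂ → Vec Bool n₂ → (r k : ℕ) → (Fin (suc k) → Fin n₁) → List ℤ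
AW E W r k x =
  deduplicate ℤ._≟_
    (filter (λ v → ∣ v ∣ ℕP.≤? 3 * r)
      (map (λ i → (+ degW E W (x (suc i))) - (+ degW E W (x zero))) (allFin k)))

allSubsets : (n : ℕ) → List (Vec Bool n)
allSubsets zero = [] ∷ []
allSubsets (suc n) = map (false ∷_) (allSubsets n) ++ map (true ∷_) (allSubsets n)

goodCount : {n₁ n₂ : ℕ} → BipGraph n₁ n₂ → ℚ → (r k : ℕ) → (Fin (suc k) → Fin n₁) → ℕ
goodCount {n₁} {n₂} E δ r k x =
  length (filter (λ W → δ ℚ.* ℕ→ℚ r ℚ.≤? ℕ→ℚ (length (AW E W r k x))) (allSubsets n₂))

-- Probabilities are counts over the 2^|V₂| subsets W. For a leaf x_i of the star, 2 (d^W(x_i) − d^W(x₀))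
-- − (d(x_i) − d(x₀)) is a sum of |N(x_i) △ N(x₀)| < (r+1)² independent signs, so by Chebyshev d^W(x_i) − d^W(x₀)
-- leaves [−3r, 3r] with probability ≤ 4/49. For two leaves, d^W(x_i) − d^W(x_j) is a shifted binomial variable
-- on |N(x_i) △ N(x_j)| ≥ ε|V₂| ≥ r²/↧ε coordinates, so the two values coincide with probability ≤ ↧ε/r. Among
-- the first t ≈ r/(24 ↧ε) leaves the expected number of out-of-range leaves plus colliding pairs is below t/8;
-- by Markov, with probability ≥ 3/4 at most t/2 leaves are spoiled, and the rest give ≥ t/2 ≥ r/(48 ↧ε)
-- distinct elements of A^W.
module Submission where

module Counting where

  open import Data.Bool using (Bool; true; false; if_then_else_)
  open import Data.Nat
  open import Data.Nat.Properties
  open import Data.Nat.Tactic.RingSolver using (solve-∀)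
  open import Algebra.Properties.CommutativeSemigroup +-commutativeSemigroup
    using () renaming (interchange to +-interchange)
  open import Data.Fin using (Fin; zero; suc)
  open import Data.Vec using (Vec; []; _∷_)
  open import Data.List using (List; []; _∷_; map; _++_; length; filter; tabulate)
  open import Data.List.Properties using (length-++; length-map)
  import Data.Bool
  open import Data.List.Relation.Unary.All using (All; []; _∷_)
  open import Data.List.Relation.Unary.Unique.Propositional using (Unique)
  open import Data.List.Relation.Unary.AllPairs using ([]; _∷_)
  open import Function using (_∘_; id)
  open import Relation.Nullary using (¬_; Dec; does; yes; no; ¬?; contradiction)
  open import Relation.Unary using (Pred; Decidable)
  open import Relation.Binary.PropositionalEquality
  open import Defs

  𝟙 : ∀ {p} {P : Set p} → Dec P → ℕ
  𝟙 P? = if does P? then 1 else 0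

  𝟙-yes : ∀ {p} {P : Set p} (P? : Dec P) → P → 𝟙 P? ≡ 1
  𝟙-yes (yes _) _ = refl
  𝟙-yes (no ¬p) p = contradiction p ¬p

  𝟙+𝟙¬ : ∀ {p} {P : Set p} (P? : Dec P) → 𝟙 P? + 𝟙 (¬? P?) ≡ 1
  𝟙+𝟙¬ (yes _) = refl
  𝟙+𝟙¬ (no _) = refl

  *𝟙-≤ : ∀ {p} {P : Set p} c (P? : Dec P) {x} → (P → c ≤ x) → c * 𝟙 P? ≤ x
  *𝟙-≤ c (yes p) c≤x = ≤-trans (≤-reflexive (*-identityʳ c)) (c≤x p)
  *𝟙-≤ c (no _) _ = ≤-trans (≤-reflexive (*-zeroʳ c)) z≤n

  𝟙-cong : ∀ {p q} {P : Set p} {Q : Set q} (P? : Dec P) (Q? : Dec Q) → (P → Q) → (Q → P) → 𝟙 P? ≡ 𝟙 Q?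
  𝟙-cong (yes _) (yes _) _ _ = refl
  𝟙-cong (yes p) (no ¬q) f _ = contradiction (f p) ¬q
  𝟙-cong (no ¬p) (yes q) _ g = contradiction (g q) ¬p
  𝟙-cong (no _) (no _) _ _ = refl

  sumOver : ∀ {a} {A : Set a} → List A → (A → ℕ) → ℕ
  sumOver [] f = 0
  sumOver (x ∷ xs) f = f x + sumOver xs f

  module _ {a} {A : Set a} where

    sumOver-++ : ∀ (xs ys : List A) f → sumOver (xs ++ ys) f ≡ sumOver xs f + sumOver ys f
    sumOver-++ [] ys f = refl
    sumOver-++ (x ∷ xs) ys f = trans (cong (f x +_) (sumOver-++ xs ys f)) (sym (+-assoc (f x) _ _))

    sumOver-map : ∀ {b} {B : Set b} (g : B → A) xs f → sumOver (map g xs) f ≡ sumOver xs (f ∘ g)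
    sumOver-map g [] f = refl
    sumOver-map g (x ∷ xs) f = cong (f (g x) +_) (sumOver-map g xs f)

    sumOver-cong : ∀ (xs : List A) {f g} → (∀ x → f x ≡ g x) → sumOver xs f ≡ sumOver xs g
    sumOver-cong [] eq = refl
    sumOver-cong (x ∷ xs) eq = cong₂ _+_ (eq x) (sumOver-cong xs eq)

    sumOver-mono : ∀ (xs : List A) {f g} → (∀ x → f x ≤ g x) → sumOver xs f ≤ sumOver xs g
    sumOver-mono [] le = z≤n
    sumOver-mono (x ∷ xs) le = +-mono-≤ (le x) (sumOver-mono xs le)

    sumOver-const : ∀ (xs : List A) c → sumOver xs (λ _ → c) ≡ length xs * c
    sumOver-const [] c = refl
    sumOver-const (x ∷ xs) c = cong (c +_) (sumOver-const xs c)

    sumOver-* : ∀ (xs : List A) c f → sumOver xs (λ x → c * f x) ≡ c * sumOver xs f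
    sumOver-* [] c f = sym (*-zeroʳ c)
    sumOver-* (x ∷ xs) c f = trans (cong (c * f x +_) (sumOver-* xs c f)) (sym (*-distribˡ-+ c _ _))

    sumOver-+ : ∀ (xs : List A) f g → sumOver xs (λ x → f x + g x) ≡ sumOver xs f + sumOver xs g
    sumOver-+ [] f g = refl
    sumOver-+ (x ∷ xs) f g =
      trans (cong (f x + g x +_) (sumOver-+ xs f g)) (+-interchange (f x) (g x) _ _)

    *-sumOver-≤ : ∀ {q} {Q : A → Set q} c b xs (f : A → ℕ) → All Q xs →
      (∀ x → Q x → c * f x ≤ b) → c * sumOver xs f ≤ length xs * b
    *-sumOver-≤ c b [] f [] _ = ≤-reflexive (*-zeroʳ c)
    *-sumOver-≤ c b (x ∷ xs) f (qx ∷ qxs) bound = begin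
      c * (f x + sumOver xs f)      ≡⟨ *-distribˡ-+ c (f x) _ ⟩
      c * f x + c * sumOver xs f    ≤⟨ +-mono-≤ (bound x qx) (*-sumOver-≤ c b xs f qxs bound) ⟩
      b + length xs * b             ∎
      where open ≤-Reasoning

    sumOver-filter-≤ : ∀ {p} {P : Pred A p} (P? : Decidable P) xs f → sumOver (filter P? xs) f ≤ sumOver xs f
    sumOver-filter-≤ P? [] f = z≤n
    sumOver-filter-≤ P? (x ∷ xs) f with P? x
    ... | yes _ = +-monoʳ-≤ (f x) (sumOver-filter-≤ P? xs f)
    ... | no _ = ≤-trans (sumOver-filter-≤ P? xs f) (m≤n+m _ (f x))

    length-filter-∷ : ∀ {p} {P : Pred A p} (P? : Decidable P) x xs →
      length (filter P? (x ∷ xs)) ≡ 𝟙 (P? x) + length (filter P? xs)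
    length-filter-∷ P? x xs with P? x
    ... | yes _ = refl
    ... | no _ = refl

    length-filter≡sumOver-𝟙 : ∀ {p} {P : Pred A p} (P? : Decidable P) xs →
      length (filter P? xs) ≡ sumOver xs (𝟙 ∘ P?)
    length-filter≡sumOver-𝟙 P? [] = refl
    length-filter≡sumOver-𝟙 P? (x ∷ xs) with P? x
    ... | yes _ = cong suc (length-filter≡sumOver-𝟙 P? xs)
    ... | no _ = length-filter≡sumOver-𝟙 P? xs

    sumOver-swap : ∀ {b} {B : Set b} (xs : List A) (ys : List B) (F : A → B → ℕ) →
      sumOver xs (λ x → sumOver ys (F x)) ≡ sumOver ys (λ y → sumOver xs (λ x → F x y))
    sumOver-swap xs [] F = trans (sumOver-const xs 0) (*-zeroʳ (length xs))
    sumOver-swap xs (y ∷ ys) F =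
      trans (sumOver-+ xs (λ x → F x y) _) (cong (sumOver xs (λ x → F x y) +_) (sumOver-swap xs ys F))

  sumSubsets : (n : ℕ) → (Vec Bool n → ℕ) → ℕ
  sumSubsets n = sumOver (allSubsets n)

  sumSubsets-suc : ∀ n f →
    sumSubsets (suc n) f ≡ sumSubsets n (f ∘ (false ∷_)) + sumSubsets n (f ∘ (true ∷_))
  sumSubsets-suc n f = begin
    sumOver (map (false ∷_) (allSubsets n) ++ map (true ∷_) (allSubsets n)) f
      ≡⟨ sumOver-++ (map (false ∷_) (allSubsets n)) _ f ⟩
    sumOver (map (false ∷_) (allSubsets n)) f + sumOver (map (true ∷_) (allSubsets n)) f
      ≡⟨ cong₂ _+_ (sumOver-map (false ∷_) (allSubsets n) f) (sumOver-map (true ∷_) (allSubsets n) f) ⟩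
    sumSubsets n (f ∘ (false ∷_)) + sumSubsets n (f ∘ (true ∷_)) ∎
    where open ≡-Reasoning

  length-allSubsets : ∀ n → length (allSubsets n) ≡ 2 ^ n
  length-allSubsets zero = refl
  length-allSubsets (suc n) = begin
    length (map (false ∷_) (allSubsets n) ++ map (true ∷_) (allSubsets n))
      ≡⟨ length-++ (map (false ∷_) (allSubsets n)) ⟩
    length (map (false ∷_) (allSubsets n)) + length (map (true ∷_) (allSubsets n))
      ≡⟨ cong₂ _+_ (length-map (false ∷_) (allSubsets n)) (length-map (true ∷_) (allSubsets n)) ⟩
    length (allSubsets n) + length (allSubsets n)
      ≡⟨ cong₂ _+_ (length-allSubsets n) (length-allSubsets n) ⟩
    2 ^ n + 2 ^ n
      ≡⟨ cong (2 ^ n +_) (+-identityʳ (2 ^ n)) ⟨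
    2 * 2 ^ n ∎
    where open ≡-Reasoning

  sumSubsets-const : ∀ n c → sumSubsets n (λ _ → c) ≡ 2 ^ n * c
  sumSubsets-const n c = trans (sumOver-const (allSubsets n) c) (cong (_* c) (length-allSubsets n))

  bit : Bool → ℕ
  bit true = 1
  bit false = 0

  count : {n : ℕ} → (Fin n → Bool) → ℕ
  count {zero} p = 0
  count {suc n} p = bit (p zero) + count (p ∘ suc)

  count≤n : ∀ {n} (p : Fin n → Bool) → count p ≤ n
  count≤n {zero} p = z≤n
  count≤n {suc n} p with p zero
  ... | true = s≤s (count≤n (p ∘ suc))
  ... | false = m≤n⇒m≤1+n (count≤n (p ∘ suc))

  countB≡count : ∀ {n} (p : Fin n → Bool) → countB p ≡ count p
  countB≡count p = count-tabulate p id
    where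
    count-tabulate : ∀ {n m} (p : Fin m → Bool) (f : Fin n → Fin m) →
      length (filter (λ j → p j Data.Bool.≟ true) (tabulate f)) ≡ count (p ∘ f)
    count-tabulate {zero} p f = refl
    count-tabulate {suc n} p f with p (f zero)
    ... | true = cong suc (count-tabulate p (f ∘ suc))
    ... | false = count-tabulate p (f ∘ suc)

  sumPairs : ∀ {a} {A : Set a} → List A → (A → A → ℕ) → ℕ
  sumPairs [] F = 0
  sumPairs (x ∷ xs) F = sumOver xs (F x) + sumPairs xs F

  module _ {a} {A : Set a} where

    sumPairs-map : ∀ {b} {B : Set b} (f : B → A) xs F →
      sumPairs (map f xs) F ≡ sumPairs xs (λ i j → F (f i) (f j))
    sumPairs-map f [] F = refl
    sumPairs-map f (x ∷ xs) F = cong₂ _+_ (sumOver-map f xs (F (f x))) (sumPairs-map f xs F)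

    sumOver-sumPairs : ∀ {b} {B : Set b} (ys : List B) (xs : List A) (F : B → A → A → ℕ) →
      sumOver ys (λ y → sumPairs xs (F y)) ≡ sumPairs xs (λ i j → sumOver ys (λ y → F y i j))
    sumOver-sumPairs ys [] F = trans (sumOver-const ys 0) (*-zeroʳ (length ys))
    sumOver-sumPairs ys (x ∷ xs) F = begin
      sumOver ys (λ y → sumOver xs (F y x) + sumPairs xs (F y))
        ≡⟨ sumOver-+ ys (λ y → sumOver xs (F y x)) _ ⟩
      sumOver ys (λ y → sumOver xs (F y x)) + sumOver ys (λ y → sumPairs xs (F y))
        ≡⟨ cong₂ _+_ (sumOver-swap ys xs (λ y → F y x)) (sumOver-sumPairs ys xs F) ⟩
      sumPairs (x ∷ xs) (λ i j → sumOver ys (λ y → F y i j)) ∎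
      where open ≡-Reasoning

    sumOver-1 : ∀ (xs : List A) → sumOver xs (λ _ → 1) ≡ length xs
    sumOver-1 xs = trans (sumOver-const xs 1) (*-identityʳ (length xs))

    pairCount : List A → ℕ
    pairCount xs = sumPairs xs (λ _ _ → 1)

    2*pairCount+length≡length² : ∀ xs → 2 * pairCount xs + length xs ≡ length xs * length xs
    2*pairCount+length≡length² [] = refl
    2*pairCount+length≡length² (x ∷ xs) = begin
      2 * (sumOver xs (λ _ → 1) + pairCount xs) + suc (length xs)
        ≡⟨ cong (λ u → 2 * (u + pairCount xs) + suc (length xs)) (sumOver-1 xs) ⟩
      2 * (length xs + pairCount xs) + suc (length xs)
        ≡⟨ regroup (length xs) (pairCount xs) ⟩
      (2 * pairCount xs + length xs) + (2 * length xs + 1)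
        ≡⟨ cong (_+ (2 * length xs + 1)) (2*pairCount+length≡length² xs) ⟩
      length xs * length xs + (2 * length xs + 1)
        ≡⟨ square-suc (length xs) ⟩
      suc (length xs) * suc (length xs) ∎
      where
      open ≡-Reasoning
      regroup : ∀ l p → 2 * (l + p) + suc l ≡ (2 * p + l) + (2 * l + 1)
      regroup = solve-∀
      square-suc : ∀ l → l * l + (2 * l + 1) ≡ suc l * suc l
      square-suc = solve-∀

    *-sumPairs-≤ : ∀ c B xs (F : A → A → ℕ) → Unique xs →
      (∀ i j → ¬ i ≡ j → c * F i j ≤ B) → c * sumPairs xs F ≤ pairCount xs * B
    *-sumPairs-≤ c B [] F [] bound = ≤-reflexive (*-zeroʳ c)
    *-sumPairs-≤ c B (x ∷ xs) F (x∉xs ∷ unique) bound = begin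
      c * (sumOver xs (F x) + sumPairs xs F)       ≡⟨ *-distribˡ-+ c _ _ ⟩
      c * sumOver xs (F x) + c * sumPairs xs F     ≤⟨ +-mono-≤ (*-sumOver-≤ c B xs (F x) x∉xs (bound x)) (*-sumPairs-≤ c B xs F unique bound) ⟩
      length xs * B + pairCount xs * B             ≡⟨ *-distribʳ-+ B (length xs) _ ⟨
      (length xs + pairCount xs) * B               ≡⟨ cong (λ u → (u + pairCount xs) * B) (sumOver-1 xs) ⟨
      pairCount (x ∷ xs) * B                       ∎
      where open ≤-Reasoning

module Binomial where

  open import Data.Nat
  open import Data.Nat.Properties
  open import Data.Nat.Combinatorics using (_C_; nCk+nC[k+1]≡[n+1]C[k+1]; nC1≡n)
  open import Data.Nat.Tactic.RingSolver using (solve-∀; solve)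
  open import Data.List using ([]; _∷_)
  open import Data.Sum using (_⊎_; inj₁; inj₂)
  open import Data.Product using (Σ-syntax; _,_)
  open import Relation.Binary.PropositionalEquality

  private
    square-mono : ∀ {a b s} → a ≤ b → a * a * s ≤ b * b * s
    square-mono {s = s} a≤b = *-monoˡ-≤ s (*-mono-≤ a≤b a≤b)

  pascal : ∀ m k → suc m C suc k ≡ m C k + m C suc k
  pascal m k = sym (nCk+nC[k+1]≡[n+1]C[k+1] m k)

  absorption : ∀ m k → suc k * (suc m C suc k) ≡ suc m * (m C k)
  absorption zero zero = refl
  absorption zero (suc k) = *-zeroʳ (suc (suc k))
  absorption (suc m) zero =
    trans (+-identityʳ _) (trans (nC1≡n (suc (suc m))) (sym (*-identityʳ (suc (suc m)))))
  absorption (suc m) (suc k) = begin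
    suc (suc k) * (suc (suc m) C suc (suc k))
      ≡⟨ cong (suc (suc k) *_) (pascal (suc m) (suc k)) ⟩
    suc (suc k) * (suc m C suc k + suc m C suc (suc k))
      ≡⟨ *-distribˡ-+ (suc (suc k)) (suc m C suc k) _ ⟩
    (suc m C suc k + suc k * (suc m C suc k)) + suc (suc k) * (suc m C suc (suc k))
      ≡⟨ cong₂ (λ u v → suc m C suc k + u + v) (absorption m k) (absorption m (suc k)) ⟩
    suc m C suc k + suc m * (m C k) + suc m * (m C suc k)
      ≡⟨ +-assoc (suc m C suc k) _ _ ⟩
    suc m C suc k + (suc m * (m C k) + suc m * (m C suc k))
      ≡⟨ cong (suc m C suc k +_) (*-distribˡ-+ (suc m) (m C k) _) ⟨
    suc m C suc k + suc m * (m C k + m C suc k)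
      ≡⟨ cong (λ u → suc m C suc k + suc m * u) (pascal m k) ⟨
    suc (suc m) * (suc m C suc k) ∎
    where open ≡-Reasoning

  -- (k+1) C(m,k+1) = (m-k) C(m,k), stated without truncated subtraction.
  ratio : ∀ m k → suc k * (m C suc k) + k * (m C k) ≡ m * (m C k)
  ratio m k = +-cancelˡ-≡ (m C k) _ _ (begin
    m C k + (suc k * (m C suc k) + k * (m C k)) ≡⟨ rearrange (m C k) (m C suc k) k ⟩
    suc k * (m C k + m C suc k)                 ≡⟨ cong (suc k *_) (pascal m k) ⟨
    suc k * (suc m C suc k)                     ≡⟨ absorption m k ⟩
    suc m * (m C k)                             ∎)
    where
    open ≡-Reasoning
    rearrange : ∀ a b k → a + (suc k * b + k * a) ≡ suc k * (a + b)
    rearrange = solve-∀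

  C-increasing : ∀ m k → suc (k + k) ≤ m → m C k ≤ m C suc k
  C-increasing m k 2k<m = *-cancelˡ-≤ (suc k) (+-cancelʳ-≤ (k * (m C k)) _ _ (begin
    suc k * (m C k) + k * (m C k)        ≡⟨ *-distribʳ-+ (m C k) (suc k) k ⟨
    suc (k + k) * (m C k)                ≤⟨ *-monoˡ-≤ (m C k) 2k<m ⟩
    m * (m C k)                          ≡⟨ ratio m k ⟨
    suc k * (m C suc k) + k * (m C k)    ∎))
    where open ≤-Reasoning

  C-decreasing : ∀ m k → m ≤ suc (k + k) → m C suc k ≤ m C k
  C-decreasing m k m≤2k+1 = *-cancelˡ-≤ (suc k) (+-cancelʳ-≤ (k * (m C k)) _ _ (begin
    suc k * (m C suc k) + k * (m C k)    ≡⟨ ratio m k ⟩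
    m * (m C k)                          ≤⟨ *-monoˡ-≤ (m C k) m≤2k+1 ⟩
    suc (k + k) * (m C k)                ≡⟨ *-distribʳ-+ (m C k) (suc k) k ⟩
    suc k * (m C k) + k * (m C k)        ∎))
    where open ≤-Reasoning

  C≤C-middle : ∀ m j → j + j ≤ m → m ≤ suc (j + j) → ∀ k → m C k ≤ m C j
  C≤C-middle m j 2j≤m m≤2j+1 k with ≤-total k j
  ... | inj₁ k≤j = below (j ∸ k) k (m+[n∸m]≡n k≤j)
    where
    below : ∀ d k → k + d ≡ j → m C k ≤ m C j
    below zero k refl rewrite +-identityʳ k = ≤-refl
    below (suc d) k refl = ≤-trans (C-increasing m k 2k<m) (below d (suc k) (sym (+-suc k d)))
      where
      k<j : k < k + suc d
      k<j = m<m+n k z<s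
      2k<m : suc (k + k) ≤ m
      2k<m = ≤-trans (+-monoʳ-< k k<j) (≤-trans (+-monoˡ-≤ (k + suc d) (<⇒≤ k<j)) 2j≤m)
  ... | inj₂ j≤k = subst (λ i → m C i ≤ m C j) (m+[n∸m]≡n j≤k) (above (k ∸ j))
    where
    above : ∀ d → m C (j + d) ≤ m C j
    above zero rewrite +-identityʳ j = ≤-refl
    above (suc d) rewrite +-suc j d =
      ≤-trans (C-decreasing m (j + d) (≤-trans m≤2j+1 (s≤s (+-mono-≤ (m≤m+n j d) (m≤m+n j d))))) (above d)

  C-middle-symmetric : ∀ j → suc (j + j) C suc j ≡ suc (j + j) C j
  C-middle-symmetric j = *-cancelˡ-≡ _ _ (suc j) (+-cancelʳ-≡ (j * c) _ _ (begin
    suc j * (suc (j + j) C suc j) + j * c ≡⟨ ratio (suc (j + j)) j ⟩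
    suc (j + j) * c                       ≡⟨ *-distribʳ-+ c (suc j) j ⟩
    suc j * c + j * c                     ∎))
    where
    open ≡-Reasoning
    c = suc (j + j) C j

  central-step : ∀ j → suc j * (suc (suc (j + j)) C suc j) ≡ 2 * suc (j + j) * ((j + j) C j)
  central-step j = begin
    suc j * (suc (suc (j + j)) C suc j)      ≡⟨ absorption (suc (j + j)) j ⟩
    suc (suc (j + j)) * (suc (j + j) C j)    ≡⟨ cong (suc (suc (j + j)) *_) (C-middle-symmetric j) ⟨
    suc (suc (j + j)) * (suc (j + j) C suc j) ≡⟨ double j (suc (j + j) C suc j) ⟩
    2 * (suc j * (suc (j + j) C suc j))      ≡⟨ cong (2 *_) (absorption (j + j) j) ⟩
    2 * (suc (j + j) * ((j + j) C j))        ≡⟨ *-assoc 2 (suc (j + j)) _ ⟨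
    2 * suc (j + j) * ((j + j) C j)          ∎
    where
    open ≡-Reasoning
    double : ∀ j d → suc (suc (j + j)) * d ≡ 2 * (suc j * d)
    double = solve-∀

  -- The central coefficient grows by the factor 2(2j+1)/(j+1) ≤ 4 √((2j+1)/(2j+3)).
  central-even-step : ∀ j c c′ P → suc j * c′ ≡ 2 * suc (j + j) * c →
    c * c * suc (j + j) ≤ P → c′ * c′ * (3 + (j + j)) ≤ 16 * P
  central-even-step j c c′ P step bound = *-cancelʳ-≤ _ _ (suc j * suc j) (begin
    c′ * c′ * (3 + (j + j)) * (suc j * suc j)                 ≡⟨ solve (j ∷ c′ ∷ []) ⟩
    (suc j * c′) * (suc j * c′) * (3 + (j + j))               ≡⟨ cong (λ u → u * u * (3 + (j + j))) step ⟩
    (2 * suc (j + j) * c) * (2 * suc (j + j) * c) * (3 + (j + j))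
      ≡⟨ solve (j ∷ c ∷ []) ⟩
    4 * suc (j + j) * (3 + (j + j)) * (c * c * suc (j + j))   ≤⟨ *-monoʳ-≤ (4 * suc (j + j) * (3 + (j + j))) bound ⟩
    4 * suc (j + j) * (3 + (j + j)) * P                       ≤⟨ *-monoˡ-≤ P (≤-trans (m≤m+n _ 4) (≤-reflexive (odd-product j))) ⟩
    16 * (suc j * suc j) * P                                  ≡⟨ solve (j ∷ P ∷ []) ⟩
    16 * P * (suc j * suc j)                                  ∎)
    where
    open ≤-Reasoning
    odd-product : ∀ j → 4 * suc (j + j) * (3 + (j + j)) + 4 ≡ 16 * (suc j * suc j)
    odd-product = solve-∀

  central-even : ∀ j → ((j + j) C j) * ((j + j) C j) * suc (j + j) ≤ 4 ^ (j + j)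
  central-even zero = ≤-refl
  central-even (suc j) = subst (λ i → (i C suc j) * (i C suc j) * suc i ≤ 4 ^ i) (sym (cong suc (+-suc j j))) (
    ≤-trans (central-even-step j ((j + j) C j) (suc (suc (j + j)) C suc j) (4 ^ (j + j)) (central-step j) (central-even j))
            (≤-reflexive (*-assoc 4 4 (4 ^ (j + j)))))

  central-odd : ∀ j → (suc (j + j) C j) * (suc (j + j) C j) * suc (suc (j + j)) ≤ 4 ^ suc (j + j)
  central-odd j = *-cancelˡ-≤ 4 (begin
    4 * (d * d * suc (suc (j + j)))             ≤⟨ *-monoʳ-≤ 4 (*-monoʳ-≤ (d * d) (n≤1+n _)) ⟩
    4 * (d * d * suc (suc (suc (j + j))))       ≡⟨ four-squares d (suc (suc (suc (j + j)))) ⟩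
    (d + d) * (d + d) * suc (suc (suc (j + j))) ≡⟨ cong (λ u → u * u * suc (suc (suc (j + j)))) next≡2d ⟨
    c′ * c′ * suc (suc (suc (j + j)))           ≤⟨ subst (λ i → (i C suc j) * (i C suc j) * suc i ≤ 4 ^ i) (cong suc (+-suc j j)) (central-even (suc j)) ⟩
    4 * (4 * 4 ^ (j + j))                       ∎)
    where
    open ≤-Reasoning
    d = suc (j + j) C j
    c′ = suc (suc (j + j)) C suc j
    next≡2d : c′ ≡ d + d
    next≡2d = trans (pascal (suc (j + j)) j) (cong (d +_) (C-middle-symmetric j))
    four-squares : ∀ d x → 4 * (d * d * x) ≡ (d + d) * (d + d) * x
    four-squares = solve-∀

  even⊎odd : ∀ m → Σ[ j ∈ ℕ ] (m ≡ j + j ⊎ m ≡ suc (j + j))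
  even⊎odd zero = 0 , inj₁ refl
  even⊎odd (suc m) with even⊎odd m
  ... | j , inj₁ refl = j , inj₂ refl
  ... | j , inj₂ refl = suc j , inj₁ (cong suc (sym (+-suc j j)))

  binomial-bound : ∀ m k → (m C k) * (m C k) * suc m ≤ 4 ^ m
  binomial-bound m k with even⊎odd m
  ... | j , inj₁ refl = ≤-trans (square-mono (C≤C-middle (j + j) j ≤-refl (n≤1+n _) k)) (central-even j)
  ... | j , inj₂ refl = ≤-trans (square-mono (C≤C-middle (suc (j + j)) j (n≤1+n _) ≤-refl k)) (central-odd j)

module RandomSigns where

  open import Data.Bool using (Bool; true; false; _∧_; _xor_; not)
  open import Data.Bool.Properties using (∧-zeroʳ; ∧-identityʳ)
  import Data.Nat as ℕ
  open import Data.Nat using (ℕ; zero; suc; _^_)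
  import Data.Nat.Properties as ℕ
  import Data.Nat.Tactic.RingSolver as NS
  open import Data.Nat.Combinatorics using (_C_)
  open Binomial using (pascal)
  open import Data.Fin using (Fin; zero; suc)
  open import Data.Vec using (Vec; _∷_; lookup)
  open import Data.Sum using (inj₁; inj₂)
  open import Function using (_∘_)
  open import Relation.Binary.PropositionalEquality
  open import Data.Integer using (ℤ; +_; -[1+_]; _+_; _*_; _-_; -_; _≟_; ∣_∣)
  open import Data.Integer.Properties using (pos-+; pos-*; +∣i∣≡i⊎+∣i∣≡-i)
  open import Data.Integer.Tactic.RingSolver using (solve-∀)
  open Counting
  open import Defs using (allSubsets)

  hits : {n : ℕ} → (Fin n → Bool) → Vec Bool n → ℕ
  hits a W = count (λ j → a j ∧ lookup W j)

  hitsDiff : {n : ℕ} → (Fin n → Bool) → (Fin n → Bool) → Vec Bool n → ℤ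
  hitsDiff a b W = + hits a W - + hits b W

  symDiff : {n : ℕ} → (Fin n → Bool) → (Fin n → Bool) → ℕ
  symDiff a b = count (λ j → a j xor b j)

  relDiff : {n : ℕ} → (Fin n → Bool) → (Fin n → Bool) → ℕ
  relDiff a b = count (λ j → a j ∧ not (b j))

  bitℤ : Bool → ℤ
  bitℤ x = + bit x

  countDiff : {n : ℕ} → (Fin n → Bool) → (Fin n → Bool) → ℤ
  countDiff a b = + count a - + count b

  private
    regroup : ∀ x y u v → (x + u) - (y + v) ≡ (x - y) + (u - v)
    regroup = solve-∀

    bit-diff² : ∀ x y → (bitℤ x - bitℤ y) * (bitℤ x - bitℤ y) ≡ bitℤ (x xor y)
    bit-diff² true true = refl
    bit-diff² true false = refl
    bit-diff² false true = refl
    bit-diff² false false = refl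

  sq : ℤ → ℕ
  sq x = ∣ x ∣ ℕ.* ∣ x ∣

  +sq≡square : ∀ x → + sq x ≡ x * x
  +sq≡square x with +∣i∣≡i⊎+∣i∣≡-i x
  ... | inj₁ eq = trans (pos-* ∣ x ∣ ∣ x ∣) (cong₂ _*_ eq eq)
  ... | inj₂ eq = trans (pos-* ∣ x ∣ ∣ x ∣) (trans (cong₂ _*_ eq eq) (neg-square x))
    where
    neg-square : ∀ x → (- x) * (- x) ≡ x * x
    neg-square = solve-∀

  module _ {n} (a b : Fin (suc n) → Bool) where

    private
      c : ℤ
      c = bitℤ (a zero) - bitℤ (b zero)

    countDiff-suc : countDiff a b ≡ c + countDiff (a ∘ suc) (b ∘ suc)
    countDiff-suc = trans (cong₂ _-_ (pos-+ (bit (a zero)) _) (pos-+ (bit (b zero)) _))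
                          (regroup (bitℤ (a zero)) (bitℤ (b zero)) (+ count (a ∘ suc)) (+ count (b ∘ suc)))

    hitsDiff-false∷ : ∀ W → hitsDiff a b (false ∷ W) ≡ hitsDiff (a ∘ suc) (b ∘ suc) W
    hitsDiff-false∷ W rewrite ∧-zeroʳ (a zero) | ∧-zeroʳ (b zero) = refl

    hitsDiff-true∷ : ∀ W → hitsDiff a b (true ∷ W) ≡ c + hitsDiff (a ∘ suc) (b ∘ suc) W
    hitsDiff-true∷ W rewrite ∧-identityʳ (a zero) | ∧-identityʳ (b zero) = begin
      + (bit (a zero) ℕ.+ hits (a ∘ suc) W) - + (bit (b zero) ℕ.+ hits (b ∘ suc) W)
        ≡⟨ cong₂ _-_ (pos-+ (bit (a zero)) _) (pos-+ (bit (b zero)) _) ⟩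
      (bitℤ (a zero) + + hits (a ∘ suc) W) - (bitℤ (b zero) + + hits (b ∘ suc) W)
        ≡⟨ regroup (bitℤ (a zero)) (bitℤ (b zero)) (+ hits (a ∘ suc) W) (+ hits (b ∘ suc) W) ⟩
      c + hitsDiff (a ∘ suc) (b ∘ suc) W ∎
      where open ≡-Reasoning

  -- Each coordinate of a △ b shifts z + 2 hitsDiff by an independent ±1 around z + countDiff.
  second-moment : ∀ n (a b : Fin n → Bool) z →
    + sumSubsets n (λ W → sq (z + + 2 * hitsDiff a b W))
      ≡ + (2 ^ n) * ((z + countDiff a b) * (z + countDiff a b) + + symDiff a b)
  second-moment zero a b z = begin
    + (sq (z + + 2 * + 0) ℕ.+ 0)       ≡⟨ cong +_ (ℕ.+-identityʳ _) ⟩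
    + sq (z + + 2 * + 0)              ≡⟨ +sq≡square (z + + 2 * + 0) ⟩
    (z + + 2 * + 0) * (z + + 2 * + 0) ≡⟨ no-coordinates z ⟩
    + 1 * ((z + + 0) * (z + + 0) + + 0) ∎
    where
    open ≡-Reasoning
    no-coordinates : ∀ z → (z + + 2 * + 0) * (z + + 2 * + 0) ≡ + 1 * ((z + + 0) * (z + + 0) + + 0)
    no-coordinates = solve-∀
  second-moment (suc n) a b z = begin
    + sumSubsets (suc n) f
      ≡⟨ cong +_ (sumSubsets-suc n f) ⟩
    + (sumSubsets n (f ∘ (false ∷_)) ℕ.+ sumSubsets n (f ∘ (true ∷_)))
      ≡⟨ pos-+ (sumSubsets n (f ∘ (false ∷_))) _ ⟩
    + sumSubsets n (f ∘ (false ∷_)) + + sumSubsets n (f ∘ (true ∷_))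
      ≡⟨ cong₂ (λ u v → + u + + v)
           (sumOver-cong (allSubsets n) (λ W → cong (λ x → sq (z + + 2 * x)) (hitsDiff-false∷ a b W)))
           (sumOver-cong (allSubsets n) (λ W → cong sq (shift (hitsDiff (a ∘ suc) (b ∘ suc) W)
                                                       (hitsDiff-true∷ a b W)))) ⟩
    + sumSubsets n (λ W → sq (z + + 2 * hitsDiff a′ b′ W))
      + + sumSubsets n (λ W → sq ((z + + 2 * c) + + 2 * hitsDiff a′ b′ W))
      ≡⟨ cong₂ _+_ (second-moment n a′ b′ z) (second-moment n a′ b′ (z + + 2 * c)) ⟩
    N * ((z + μ) * (z + μ) + + m) + N * ((z + + 2 * c + μ) * (z + + 2 * c + μ) + + m)
      ≡⟨ parallelogram N z c μ (+ m) ⟩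
    (+ 2 * N) * ((z + (c + μ)) * (z + (c + μ)) + (c * c + + m))
      ≡⟨ cong₂ (λ u v → u * ((z + v) * (z + v) + (c * c + + m))) (sym (pos-* 2 (2 ^ n))) (sym (countDiff-suc a b)) ⟩
    + (2 ^ suc n) * ((z + countDiff a b) * (z + countDiff a b) + (c * c + + m))
      ≡⟨ cong (λ u → + (2 ^ suc n) * ((z + countDiff a b) * (z + countDiff a b) + u))
           (trans (cong (_+ + m) (bit-diff² (a zero) (b zero))) (sym (pos-+ (bit (a zero xor b zero)) m))) ⟩
    + (2 ^ suc n) * ((z + countDiff a b) * (z + countDiff a b) + + symDiff a b) ∎
    where
    open ≡-Reasoning
    a′ = a ∘ suc
    b′ = b ∘ suc
    c = bitℤ (a zero) - bitℤ (b zero)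
    μ = countDiff a′ b′
    m = symDiff a′ b′
    N = + (2 ^ n)
    f = λ W → sq (z + + 2 * hitsDiff a b W)
    shift : ∀ x {y} → y ≡ c + x → z + + 2 * y ≡ (z + + 2 * c) + + 2 * x
    shift x refl = distrib z c x
      where
      distrib : ∀ z c x → z + + 2 * (c + x) ≡ (z + + 2 * c) + + 2 * x
      distrib = solve-∀
    parallelogram : ∀ N z c μ M →
      N * ((z + μ) * (z + μ) + M) + N * ((z + + 2 * c + μ) * (z + + 2 * c + μ) + M)
        ≡ (+ 2 * N) * ((z + (c + μ)) * (z + (c + μ)) + (c * c + M))
    parallelogram = solve-∀

  levelCount : ∀ n → (a b : Fin n → Bool) → ℤ → ℕ
  levelCount n a b t = sumSubsets n (λ W → 𝟙 (hitsDiff a b W ≟ t))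

  levelCount-suc : ∀ {n} (a b : Fin (suc n) → Bool) t →
    levelCount (suc n) a b t
      ≡ levelCount n (a ∘ suc) (b ∘ suc) t ℕ.+ levelCount n (a ∘ suc) (b ∘ suc) (t - (bitℤ (a zero) - bitℤ (b zero)))
  levelCount-suc {n} a b t = trans (sumSubsets-suc n _) (cong₂ ℕ._+_
    (sumOver-cong (allSubsets n) (λ W → cong (λ x → 𝟙 (x ≟ t)) (hitsDiff-false∷ a b W)))
    (sumOver-cong (allSubsets n) (λ W → trans (cong (λ x → 𝟙 (x ≟ t)) (hitsDiff-true∷ a b W)) (shifted _))))
    where
    c = bitℤ (a zero) - bitℤ (b zero)
    cancel : ∀ c y → y ≡ (c + y) - c
    cancel = solve-∀
    uncancel : ∀ t c → t ≡ c + (t - c)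
    uncancel = solve-∀
    shifted : ∀ y → 𝟙 (c + y ≟ t) ≡ 𝟙 (y ≟ t - c)
    shifted y = 𝟙-cong (c + y ≟ t) (y ≟ t - c)
      (λ eq → trans (cancel c y) (cong (_- c) eq))
      (λ eq → trans (cong (λ u → c + u) eq) (sym (uncancel t c)))

  Cℤ : ℕ → ℤ → ℕ
  Cℤ m (+ k) = m C k
  Cℤ m -[1+ k ] = 0

  Cℤ-pascal : ∀ m z → Cℤ (suc m) z ≡ Cℤ m z ℕ.+ Cℤ m (z - + 1)
  Cℤ-pascal m (+ zero) = refl
  Cℤ-pascal m (+ suc k) = trans (pascal m k) (ℕ.+-comm (m C k) (m C suc k))
  Cℤ-pascal m -[1+ k ] = refl

  private
    doubled : ∀ M P x u → M ℕ.* x ≡ P ℕ.* u → M ℕ.* (x ℕ.+ x) ≡ (2 ℕ.* P) ℕ.* u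
    doubled M P x u e = trans (ℕ.*-distribˡ-+ M x x) (trans (cong₂ ℕ._+_ e e) (double P u))
      where
      double : ∀ P u → P ℕ.* u ℕ.+ P ℕ.* u ≡ (2 ℕ.* P) ℕ.* u
      double = NS.solve-∀

    pascal-step : ∀ m n x y z → 2 ^ m ℕ.* x ≡ 2 ^ n ℕ.* Cℤ m z → 2 ^ m ℕ.* y ≡ 2 ^ n ℕ.* Cℤ m (z - + 1) →
      2 ^ suc m ℕ.* (x ℕ.+ y) ≡ 2 ^ suc n ℕ.* Cℤ (suc m) z
    pascal-step m n x y z e₁ e₂ = begin
      2 ℕ.* 2 ^ m ℕ.* (x ℕ.+ y)                             ≡⟨ ℕ.*-assoc 2 (2 ^ m) _ ⟩
      2 ℕ.* (2 ^ m ℕ.* (x ℕ.+ y))                           ≡⟨ cong (2 ℕ.*_) (trans (ℕ.*-distribˡ-+ (2 ^ m) x y) (cong₂ ℕ._+_ e₁ e₂)) ⟩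
      2 ℕ.* (2 ^ n ℕ.* Cℤ m z ℕ.+ 2 ^ n ℕ.* Cℤ m (z - + 1)) ≡⟨ cong (2 ℕ.*_) (ℕ.*-distribˡ-+ (2 ^ n) _ _) ⟨
      2 ℕ.* (2 ^ n ℕ.* (Cℤ m z ℕ.+ Cℤ m (z - + 1)))         ≡⟨ cong (λ u → 2 ℕ.* (2 ^ n ℕ.* u)) (Cℤ-pascal m z) ⟨
      2 ℕ.* (2 ^ n ℕ.* Cℤ (suc m) z)                        ≡⟨ ℕ.*-assoc 2 (2 ^ n) _ ⟨
      2 ^ suc n ℕ.* Cℤ (suc m) z                            ∎
      where open ≡-Reasoning

    zero-shift : ∀ t → t - + 0 ≡ t
    zero-shift = solve-∀

  level-count : ∀ n (a b : Fin n → Bool) t →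
    2 ^ symDiff a b ℕ.* levelCount n a b t ≡ 2 ^ n ℕ.* Cℤ (symDiff a b) (t + + relDiff b a)
  level-count zero a b (+ zero) = refl
  level-count zero a b (+ suc k) = refl
  level-count zero a b -[1+ k ] = refl
  level-count (suc n) a b t rewrite levelCount-suc a b t with a zero | b zero
  ... | true | false = pascal-step (symDiff a′ b′) n _ _ (t + + relDiff b′ a′) (level-count n a′ b′ t)
    (trans (level-count n a′ b′ (t - + 1)) (cong (λ z → 2 ^ n ℕ.* Cℤ (symDiff a′ b′) z) (pred-shift t _)))
    where
    a′ = a ∘ suc
    b′ = b ∘ suc
    pred-shift : ∀ t q → (t - + 1) + q ≡ (t + q) - + 1
    pred-shift = solve-∀
  ... | false | true = trans (cong (2 ^ suc (symDiff a′ b′) ℕ.*_) (ℕ.+-comm (levelCount n a′ b′ t) _))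
    (pascal-step (symDiff a′ b′) n _ _ (t + + suc (relDiff b′ a′))
      (trans (level-count n a′ b′ (t - -[1+ 0 ])) (cong (λ z → 2 ^ n ℕ.* Cℤ (symDiff a′ b′) z) (succ-shift t _)))
      (trans (level-count n a′ b′ t) (cong (λ z → 2 ^ n ℕ.* Cℤ (symDiff a′ b′) z) (unshift t _))))
    where
    a′ = a ∘ suc
    b′ = b ∘ suc
    succ-shift : ∀ t q → (t - -[1+ 0 ]) + q ≡ t + (+ 1 + q)
    succ-shift = solve-∀
    unshift : ∀ t q → t + q ≡ (t + (+ 1 + q)) - + 1
    unshift = solve-∀
  ... | true | true rewrite zero-shift t =
    doubled (2 ^ symDiff a′ b′) (2 ^ n) (levelCount n a′ b′ t) _ (level-count n a′ b′ t)
    where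
    a′ = a ∘ suc
    b′ = b ∘ suc
  ... | false | false rewrite zero-shift t =
    doubled (2 ^ symDiff a′ b′) (2 ^ n) (levelCount n a′ b′ t) _ (level-count n a′ b′ t)
    where
    a′ = a ∘ suc
    b′ = b ∘ suc

module Concentration where

  open import Data.Bool using (Bool)
  open import Data.Nat
  open import Data.Nat.Properties
  open import Data.Nat.Tactic.RingSolver using (solve-∀)
  open import Algebra.Properties.CommutativeSemigroup *-commutativeSemigroup using (x∙yz≈y∙xz)
  open import Data.Fin using (Fin)
  open import Data.Sum using (inj₁; inj₂)
  open import Relation.Nullary using (¬_; ¬?; yes; no; contradiction)
  open import Relation.Binary.PropositionalEquality
  open import Data.Integer as ℤ using (ℤ; +_; ∣_∣)
  import Data.Integer.Properties as ℤ
  import Data.Integer.Tactic.RingSolver as ZS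
  open import Defs using (allSubsets)
  open Counting
  open Binomial using (binomial-bound)
  open RandomSigns

  4^n≡2^n*2^n : ∀ n → 4 ^ n ≡ 2 ^ n * 2 ^ n
  4^n≡2^n*2^n zero = refl
  4^n≡2^n*2^n (suc n) = trans (cong (4 *_) (4^n≡2^n*2^n n)) (four-times (2 ^ n))
    where
    four-times : ∀ x → 4 * (x * x) ≡ (2 * x) * (2 * x)
    four-times = solve-∀

  square-cancel-≤ : ∀ m n → m * m ≤ n * n → m ≤ n
  square-cancel-≤ m n m²≤n² with m ≤? n
  ... | yes m≤n = m≤n
  ... | no m≰n = contradiction m²≤n² (<⇒≱ (*-mono-< (≰⇒> m≰n) (≰⇒> m≰n)))

  Cℤ-bound : ∀ m z → Cℤ m z * Cℤ m z * suc m ≤ 4 ^ m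
  Cℤ-bound m (+ k) = binomial-bound m k
  Cℤ-bound m ℤ.-[1+ k ] = z≤n

  levelCount²*[1+symDiff]≤4^n : ∀ n (a b : Fin n → Bool) t →
    levelCount n a b t * levelCount n a b t * suc (symDiff a b) ≤ 4 ^ n
  levelCount²*[1+symDiff]≤4^n n a b t = *-cancelʳ-≤ _ _ (4 ^ m) {{m^n≢0 4 m}} (begin
    L * L * suc m * 4 ^ m                         ≡⟨ cong (L * L * suc m *_) (4^n≡2^n*2^n m) ⟩
    L * L * suc m * (2 ^ m * 2 ^ m)               ≡⟨ regroup L (2 ^ m) (suc m) ⟩
    (2 ^ m * L) * (2 ^ m * L) * suc m             ≡⟨ cong (λ u → u * u * suc m) (level-count n a b t) ⟩
    (2 ^ n * B) * (2 ^ n * B) * suc m             ≡⟨ regroup′ (2 ^ n) B (suc m) ⟩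
    2 ^ n * 2 ^ n * (B * B * suc m)               ≤⟨ *-monoʳ-≤ (2 ^ n * 2 ^ n) (Cℤ-bound m (t ℤ.+ + relDiff b a)) ⟩
    2 ^ n * 2 ^ n * 4 ^ m                         ≡⟨ cong (_* 4 ^ m) (4^n≡2^n*2^n n) ⟨
    4 ^ n * 4 ^ m                                 ∎)
    where
    open ≤-Reasoning
    m = symDiff a b
    L = levelCount n a b t
    B = Cℤ m (t ℤ.+ + relDiff b a)
    regroup : ∀ L P s → L * L * s * (P * P) ≡ (P * L) * (P * L) * s
    regroup = solve-∀
    regroup′ : ∀ P B s → (P * B) * (P * B) * s ≡ P * P * (B * B * s)
    regroup′ = solve-∀

  anticoncentration : ∀ n (a b : Fin n → Bool) t r s .{{_ : NonZero s}} →
    r * r ≤ n → n ≤ s * symDiff a b → levelCount n a b t * r ≤ s * 2 ^ n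
  anticoncentration n a b t r s r²≤n n≤s·m = square-cancel-≤ _ _ (begin
    (L * r) * (L * r)               ≡⟨ regroup L r ⟩
    L * L * (r * r)                 ≤⟨ *-monoʳ-≤ (L * L) (≤-trans r²≤n (≤-trans n≤s·m (*-monoʳ-≤ s (n≤1+n m)))) ⟩
    L * L * (s * suc m)             ≡⟨ x∙yz≈y∙xz (L * L) s (suc m) ⟩
    s * (L * L * suc m)             ≤⟨ *-monoʳ-≤ s (levelCount²*[1+symDiff]≤4^n n a b t) ⟩
    s * 4 ^ n                       ≤⟨ *-monoˡ-≤ (4 ^ n) (m≤m*n s s) ⟩
    s * s * 4 ^ n                   ≡⟨ cong (s * s *_) (4^n≡2^n*2^n n) ⟩
    s * s * (2 ^ n * 2 ^ n)         ≡⟨ regroup′ s (2 ^ n) ⟩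
    (s * 2 ^ n) * (s * 2 ^ n)       ∎)
    where
    open ≤-Reasoning
    m = symDiff a b
    L = levelCount n a b t
    regroup : ∀ L r → (L * r) * (L * r) ≡ L * L * (r * r)
    regroup = solve-∀
    regroup′ : ∀ s P → s * s * (P * P) ≡ (s * P) * (s * P)
    regroup′ = solve-∀

  ∣+m-+n∣≤ : ∀ m n r → m ≤ n + r → n ≤ m + r → ∣ + m ℤ.- + n ∣ ≤ r
  ∣+m-+n∣≤ m n r m≤n+r n≤m+r rewrite ℤ.m-n≡m⊖n m n with ≤-total m n
  ... | inj₁ m≤n = subst (_≤ r) (sym (ℤ.∣⊖∣-≤ m≤n)) (m≤n+o⇒m∸n≤o n m n≤m+r)
  ... | inj₂ n≤m = subst (_≤ r) (sym (trans (ℤ.∣m⊖n∣≡∣n⊖m∣ m n) (ℤ.∣⊖∣-≤ n≤m))) (m≤n+o⇒m∸n≤o m n m≤n+r)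

  far-from-mean : ∀ r X μ → 3 * r < ∣ X ∣ → ∣ μ ∣ ≤ r → 2 + 5 * r ≤ ∣ ℤ.- μ ℤ.+ + 2 ℤ.* X ∣
  far-from-mean r X μ 3r<∣X∣ ∣μ∣≤r = +-cancelʳ-≤ r _ _ (begin
    2 + 5 * r + r                          ≡⟨ six-r r ⟩
    2 * suc (3 * r)                        ≤⟨ *-monoʳ-≤ 2 3r<∣X∣ ⟩
    2 * ∣ X ∣                              ≡⟨ ℤ.abs-* (+ 2) X ⟨
    ∣ + 2 ℤ.* X ∣                          ≡⟨ cong ∣_∣ (recentre μ (+ 2 ℤ.* X)) ⟩
    ∣ (ℤ.- μ ℤ.+ + 2 ℤ.* X) ℤ.+ μ ∣        ≤⟨ ℤ.∣i+j∣≤∣i∣+∣j∣ (ℤ.- μ ℤ.+ + 2 ℤ.* X) μ ⟩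
    ∣ ℤ.- μ ℤ.+ + 2 ℤ.* X ∣ + ∣ μ ∣        ≤⟨ +-monoʳ-≤ ∣ ℤ.- μ ℤ.+ + 2 ℤ.* X ∣ ∣μ∣≤r ⟩
    ∣ ℤ.- μ ℤ.+ + 2 ℤ.* X ∣ + r            ∎)
    where
    open ≤-Reasoning
    six-r : ∀ r → 2 + 5 * r + r ≡ 2 * suc (3 * r)
    six-r = solve-∀
    recentre : ∀ μ Y → Y ≡ (ℤ.- μ ℤ.+ Y) ℤ.+ μ
    recentre = ZS.solve-∀

  -- 2 hitsDiff − countDiff has second moment |a △ b| < (r+1)² and exceeds 5r+1 wherever |hitsDiff| > 3r.
  chebyshev : ∀ n (a b : Fin n → Bool) r → n < suc r * suc r → ∣ countDiff a b ∣ ≤ r →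
    (2 + 5 * r) * (2 + 5 * r) * sumSubsets n (λ W → 𝟙 (¬? (∣ hitsDiff a b W ∣ ≤? 3 * r))) ≤ 2 ^ n * (suc r * suc r)
  chebyshev n a b r n<[r+1]² ∣μ∣≤r = begin
    K * sumSubsets n (λ W → 𝟙 (¬? (∣ hitsDiff a b W ∣ ≤? 3 * r)))   ≡⟨ sumOver-* (allSubsets n) K _ ⟨
    sumSubsets n (λ W → K * 𝟙 (¬? (∣ hitsDiff a b W ∣ ≤? 3 * r)))   ≤⟨ sumOver-mono (allSubsets n) pointwise ⟩
    sumSubsets n (λ W → sq (D W))                                   ≡⟨ centred-second-moment ⟩
    2 ^ n * symDiff a b                                             ≤⟨ *-monoʳ-≤ (2 ^ n) (≤-trans (count≤n _) (<⇒≤ n<[r+1]²)) ⟩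
    2 ^ n * (suc r * suc r)                                         ∎
    where
    open ≤-Reasoning
    K = (2 + 5 * r) * (2 + 5 * r)
    μ = countDiff a b
    D = λ W → ℤ.- μ ℤ.+ + 2 ℤ.* hitsDiff a b W
    pointwise : ∀ W → K * 𝟙 (¬? (∣ hitsDiff a b W ∣ ≤? 3 * r)) ≤ sq (D W)
    pointwise W = *𝟙-≤ K (¬? (∣ hitsDiff a b W ∣ ≤? 3 * r)) (λ far → *-mono-≤ (bound far) (bound far))
      where
      bound : ¬ ∣ hitsDiff a b W ∣ ≤ 3 * r → 2 + 5 * r ≤ ∣ D W ∣
      bound far = far-from-mean r _ μ (≰⇒> far) ∣μ∣≤r
    centred-second-moment : sumSubsets n (λ W → sq (D W)) ≡ 2 ^ n * symDiff a b
    centred-second-moment = ℤ.+-injective (trans (second-moment n a b (ℤ.- μ))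
      (trans (cong (+ (2 ^ n) ℤ.*_) (cancel μ (+ symDiff a b))) (sym (ℤ.pos-* (2 ^ n) (symDiff a b)))))
      where
      cancel : ∀ μ m → (ℤ.- μ ℤ.+ μ) ℤ.* (ℤ.- μ ℤ.+ μ) ℤ.+ m ≡ m
      cancel = ZS.solve-∀

  large-deviation : ∀ n (a b : Fin n → Bool) r → 1 ≤ r → n < suc r * suc r →
    count a ≤ count b + r → count b ≤ count a + r →
    49 * sumSubsets n (λ W → 𝟙 (¬? (∣ hitsDiff a b W ∣ ≤? 3 * r))) ≤ 4 * 2 ^ n
  large-deviation n a b (suc r′) _ n<[r+1]² ca≤cb+r cb≤ca+r = *-cancelʳ-≤ (49 * S) (4 * 2 ^ n) K (begin
    49 * S * K                        ≡⟨ trans (*-assoc 49 S K) (cong (49 *_) (*-comm S K)) ⟩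
    49 * (K * S)                      ≤⟨ *-monoʳ-≤ 49 (chebyshev n a b r n<[r+1]² (∣+m-+n∣≤ (count a) (count b) r ca≤cb+r cb≤ca+r)) ⟩
    49 * (2 ^ n * (suc r * suc r))    ≡⟨ x∙yz≈y∙xz 49 (2 ^ n) _ ⟩
    2 ^ n * (49 * (suc r * suc r))    ≤⟨ *-monoʳ-≤ (2 ^ n) (≤-trans (m≤m+n _ _) (≤-reflexive (constants r′))) ⟩
    2 ^ n * (4 * K)                   ≡⟨ x∙yz≈y∙xz (2 ^ n) 4 K ⟩
    4 * (2 ^ n * K)                   ≡⟨ *-assoc 4 (2 ^ n) K ⟨
    4 * 2 ^ n * K                     ∎)
    where
    open ≤-Reasoning
    r = suc r′
    K = (2 + 5 * r) * (2 + 5 * r)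
    S = sumSubsets n (λ W → 𝟙 (¬? (∣ hitsDiff a b W ∣ ≤? 3 * r)))
    constants : ∀ r′ → 49 * (suc (suc r′) * suc (suc r′)) + (51 * (r′ * r′) + 84 * r′)
      ≡ 4 * ((2 + 5 * suc r′) * (2 + 5 * suc r′))
    constants = solve-∀

module Distinct where

  open import Data.Nat
  open import Data.Nat.Properties
  open import Algebra.Properties.CommutativeSemigroup +-commutativeSemigroup using (xy∙z≈xz∙y; xy∙z≈y∙xz)
  open import Data.List using (List; []; _∷_; _++_; length; filter; deduplicate)
  open import Data.List.Properties using (filter-++; filter-all)
  open import Data.List.Relation.Unary.All using (universal-U)
  open import Function using (_∘_)
  open import Relation.Nullary using (yes; no; ¬?)
  open import Relation.Unary using (Pred; Decidable)
  open import Relation.Unary.Properties using (U?; _∩?_)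
  open import Relation.Binary.Definitions using (DecidableEquality)
  open import Relation.Binary.PropositionalEquality
  open Counting

  module _ {a p q} {A : Set a} {P : Pred A p} {Q : Pred A q} (Q? : Decidable Q) (P? : Decidable P) where

    length-filter-filter : ∀ xs → length (filter Q? (filter P? xs)) ≡ length (filter (Q? ∩? P?) xs)
    length-filter-filter [] = refl
    length-filter-filter (x ∷ xs) with P? x
    ... | yes _ with Q? x
    ...   | yes _ = cong suc (length-filter-filter xs)
    ...   | no _ = length-filter-filter xs
    length-filter-filter (x ∷ xs) | no _ with Q? x
    ...   | yes _ = length-filter-filter xs
    ...   | no _ = length-filter-filter xs

    length-filter-filter-≤ : ∀ xs → length (filter Q? (filter P? xs)) ≤ length (filter Q? xs)
    length-filter-filter-≤ [] = z≤n
    length-filter-filter-≤ (x ∷ xs) with P? x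
    ... | yes _ with Q? x
    ...   | yes _ = s≤s (length-filter-filter-≤ xs)
    ...   | no _ = length-filter-filter-≤ xs
    length-filter-filter-≤ (x ∷ xs) | no _ with Q? x
    ...   | yes _ = m≤n⇒m≤1+n (length-filter-filter-≤ xs)
    ...   | no _ = length-filter-filter-≤ xs

  length-filter+length-filter¬ : ∀ {a p} {A : Set a} {P : Pred A p} (P? : Decidable P) xs →
    length xs ≡ length (filter P? xs) + length (filter (¬? ∘ P?) xs)
  length-filter+length-filter¬ P? [] = refl
  length-filter+length-filter¬ P? (x ∷ xs) with P? x
  ... | yes _ = cong suc (length-filter+length-filter¬ P? xs)
  ... | no _ = trans (cong suc (length-filter+length-filter¬ P? xs)) (sym (+-suc _ _))

  module _ {a} {A : Set a} (_≟_ : DecidableEquality A) where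

    private
      dedup : List A → List A
      dedup = deduplicate _≟_

    collisions : List A → ℕ
    collisions xs = sumPairs xs (λ x y → 𝟙 (x ≟ y))

    length-filter-dedup-≤ : ∀ {q} {Q : Pred A q} (Q? : Decidable Q) xs →
      length (filter Q? (dedup xs)) ≤ length (filter Q? xs)
    length-filter-dedup-≤ Q? [] = z≤n
    length-filter-dedup-≤ Q? (x ∷ xs) with Q? x
    ... | yes _ = s≤s (≤-trans (length-filter-filter-≤ Q? (¬? ∘ (x ≟_)) (dedup xs)) (length-filter-dedup-≤ Q? xs))
    ... | no _ = ≤-trans (length-filter-filter-≤ Q? (¬? ∘ (x ≟_)) (dedup xs)) (length-filter-dedup-≤ Q? xs)

    length-filter-dedup-++ : ∀ {q} {Q : Pred A q} (Q? : Decidable Q) xs ys →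
      length (filter Q? (dedup xs)) ≤ length (filter Q? (dedup (xs ++ ys)))
    length-filter-dedup-++ Q? [] ys = z≤n
    length-filter-dedup-++ Q? (x ∷ xs) ys = begin
      length (filter Q? (x ∷ filter R? (dedup xs)))            ≡⟨ length-filter-∷ Q? x _ ⟩
      𝟙 (Q? x) + length (filter Q? (filter R? (dedup xs)))      ≡⟨ cong (𝟙 (Q? x) +_) (length-filter-filter Q? R? (dedup xs)) ⟩
      𝟙 (Q? x) + length (filter (Q? ∩? R?) (dedup xs))          ≤⟨ +-monoʳ-≤ (𝟙 (Q? x)) (length-filter-dedup-++ (Q? ∩? R?) xs ys) ⟩
      𝟙 (Q? x) + length (filter (Q? ∩? R?) (dedup (xs ++ ys)))  ≡⟨ cong (𝟙 (Q? x) +_) (length-filter-filter Q? R? (dedup (xs ++ ys))) ⟨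
      𝟙 (Q? x) + length (filter Q? (filter R? (dedup (xs ++ ys)))) ≡⟨ length-filter-∷ Q? x _ ⟨
      length (filter Q? (x ∷ filter R? (dedup (xs ++ ys))))    ∎
      where
      open ≤-Reasoning
      R? = ¬? ∘ (x ≟_)

    length≤length-dedup+collisions : ∀ xs → length xs ≤ length (dedup xs) + collisions xs
    length≤length-dedup+collisions [] = z≤n
    length≤length-dedup+collisions (x ∷ xs) = s≤s (begin
      length xs                                        ≤⟨ length≤length-dedup+collisions xs ⟩
      length D + collisions xs                         ≡⟨ cong (_+ collisions xs) (length-filter+length-filter¬ (x ≟_) D) ⟩
      length (filter (x ≟_) D) + length (filter R? D) + collisions xs
        ≤⟨ +-monoˡ-≤ (collisions xs) (+-monoˡ-≤ (length (filter R? D)) copies-of-x) ⟩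
      sumOver xs (𝟙 ∘ (x ≟_)) + length (filter R? D) + collisions xs
        ≡⟨ xy∙z≈y∙xz (sumOver xs (𝟙 ∘ (x ≟_))) (length (filter R? D)) (collisions xs) ⟩
      length (filter R? D) + collisions (x ∷ xs)       ∎)
      where
      open ≤-Reasoning
      D = dedup xs
      R? = ¬? ∘ (x ≟_)
      copies-of-x : length (filter (x ≟_) D) ≤ sumOver xs (𝟙 ∘ (x ≟_))
      copies-of-x = ≤-trans (length-filter-dedup-≤ (x ≟_) xs) (≤-reflexive (length-filter≡sumOver-𝟙 (x ≟_) xs))

    collisions-filter-≤ : ∀ {p} {P : Pred A p} (P? : Decidable P) xs → collisions (filter P? xs) ≤ collisions xs
    collisions-filter-≤ P? [] = z≤n
    collisions-filter-≤ P? (x ∷ xs) with P? x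
    ... | yes _ = +-mono-≤ (sumOver-filter-≤ P? xs (𝟙 ∘ (x ≟_))) (collisions-filter-≤ P? xs)
    ... | no _ = ≤-trans (collisions-filter-≤ P? xs) (m≤n+m _ _)

    -- Every entry of vs that is in range and not repeated later in vs gives a distinct value in range.
    length≤distinct-in-range+out-of-range+collisions : ∀ {p} {P : Pred A p} (P? : Decidable P) vs rest →
      length vs ≤ length (dedup (filter P? (vs ++ rest))) + length (filter (¬? ∘ P?) vs) + collisions vs
    length≤distinct-in-range+out-of-range+collisions P? vs rest = begin
      length vs                                                ≡⟨ length-filter+length-filter¬ P? vs ⟩
      length (filter P? vs) + out                              ≤⟨ +-monoˡ-≤ out (length≤length-dedup+collisions (filter P? vs)) ⟩
      length (dedup (filter P? vs)) + collisions (filter P? vs) + out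
        ≤⟨ +-monoˡ-≤ out (+-mono-≤ dedup-prefix (collisions-filter-≤ P? vs)) ⟩
      length (dedup (filter P? (vs ++ rest))) + collisions vs + out
        ≡⟨ xy∙z≈xz∙y (length (dedup (filter P? (vs ++ rest)))) (collisions vs) out ⟩
      length (dedup (filter P? (vs ++ rest))) + out + collisions vs ∎
      where
      open ≤-Reasoning
      out = length (filter (¬? ∘ P?) vs)
      unfiltered : ∀ ys → filter U? ys ≡ ys
      unfiltered ys = filter-all U? (universal-U ys)
      dedup-prefix : length (dedup (filter P? vs)) ≤ length (dedup (filter P? (vs ++ rest)))
      dedup-prefix = subst₂ (λ us ws → length us ≤ length ws)
        (unfiltered (dedup (filter P? vs))) (trans (unfiltered _) (cong dedup (sym (filter-++ P? vs rest))))
        (length-filter-dedup-++ U? (filter P? vs) (filter P? rest))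

module Rationals where

  open import Data.Nat as ℕ using (ℕ; suc)
  import Data.Nat.Properties as ℕ
  open import Data.Nat.Coprimality using (1-coprimeTo)
  open import Data.Integer as ℤ using (ℤ; +_)
  import Data.Integer.Properties as ℤ
  open import Data.Integer.GCD using (gcd)
  open import Data.Integer.Tactic.RingSolver using (solve-∀)
  open import Data.Rational as ℚ using (ℚ; mkℚ; Positive; ↥_; ↧_; toℚᵘ)
  import Data.Rational.Properties as ℚ
  open import Data.Rational.Unnormalised as ℚᵘ using (ℚᵘ; mkℚᵘ; *≡*; *≤*)
  import Data.Rational.Unnormalised.Properties as ℚᵘ
  open import Relation.Binary.PropositionalEquality
  open import Defs using (ℕ→ℚ)

  toℚᵘ-ℕ→ℚ : ∀ n → toℚᵘ (ℕ→ℚ n) ℚᵘ.≃ mkℚᵘ (+ n) 0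
  toℚᵘ-ℕ→ℚ n = *≡* (begin
    ℚᵘ.↥ (toℚᵘ (ℕ→ℚ n)) ℤ.* + 1         ≡⟨ cong (ℤ._* + 1) (ℚ.↥ᵘ-toℚᵘ (ℕ→ℚ n)) ⟩
    ↥ (ℕ→ℚ n) ℤ.* + 1                   ≡⟨ cong (↥ (ℕ→ℚ n) ℤ.*_) (ℚ.↧-/ (+ n) 1) ⟨
    ↥ (ℕ→ℚ n) ℤ.* (↧ (ℕ→ℚ n) ℤ.* g)     ≡⟨ rotate (↥ (ℕ→ℚ n)) (↧ (ℕ→ℚ n)) g ⟩
    (↥ (ℕ→ℚ n) ℤ.* g) ℤ.* ↧ (ℕ→ℚ n)     ≡⟨ cong (ℤ._* ↧ (ℕ→ℚ n)) (ℚ.↥-/ (+ n) 1) ⟩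
    + n ℤ.* ↧ (ℕ→ℚ n)                   ≡⟨ cong (+ n ℤ.*_) (ℚ.↧ᵘ-toℚᵘ (ℕ→ℚ n)) ⟨
    + n ℤ.* ℚᵘ.↧ (toℚᵘ (ℕ→ℚ n))         ∎)
    where
    open ≡-Reasoning
    g = gcd (+ n) (+ 1)
    rotate : ∀ a b g → a ℤ.* (b ℤ.* g) ≡ (a ℤ.* g) ℤ.* b
    rotate = solve-∀

  module _ (p : ℚ) (n m : ℕ) where

    private
      scale-≃ : toℚᵘ (p ℚ.* ℕ→ℚ n) ℚᵘ.≃ toℚᵘ p ℚᵘ.* mkℚᵘ (+ n) 0
      scale-≃ = ℚᵘ.≃-trans (ℚ.toℚᵘ-homo-* p (ℕ→ℚ n)) (ℚᵘ.*-congˡ {toℚᵘ p} (toℚᵘ-ℕ→ℚ n))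

    toℚᵘ-*ℕ→ℚ-≤ : p ℚ.* ℕ→ℚ n ℚ.≤ ℕ→ℚ m → toℚᵘ p ℚᵘ.* mkℚᵘ (+ n) 0 ℚᵘ.≤ mkℚᵘ (+ m) 0
    toℚᵘ-*ℕ→ℚ-≤ le = ℚᵘ.≤-respʳ-≃ (toℚᵘ-ℕ→ℚ m) (ℚᵘ.≤-respˡ-≃ scale-≃ (ℚ.toℚᵘ-mono-≤ le))

    fromℚᵘ-*ℕ→ℚ-≤ : toℚᵘ p ℚᵘ.* mkℚᵘ (+ n) 0 ℚᵘ.≤ mkℚᵘ (+ m) 0 → p ℚ.* ℕ→ℚ n ℚ.≤ ℕ→ℚ m
    fromℚᵘ-*ℕ→ℚ-≤ le = ℚ.toℚᵘ-cancel-≤ (ℚᵘ.≤-respʳ-≃ (ℚᵘ.≃-sym (toℚᵘ-ℕ→ℚ m)) (ℚᵘ.≤-respˡ-≃ (ℚᵘ.≃-sym scale-≃) le))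

  -- A positive ε is at least 1 / ↧ε.
  ε*n≤m⇒n≤↧ε*m : ∀ ε n m → Positive ε → ε ℚ.* ℕ→ℚ n ℚ.≤ ℕ→ℚ m → n ℕ.≤ ℚ.↧ₙ ε ℕ.* m
  ε*n≤m⇒n≤↧ε*m (mkℚ (+ suc k) d coprime) n m _ le = begin
    n                         ≤⟨ ℕ.m≤m*n n (suc k) ⟩
    n ℕ.* suc k               ≡⟨ ℕ.*-comm n (suc k) ⟩
    suc k ℕ.* n               ≡⟨ ℕ.*-identityʳ _ ⟨
    suc k ℕ.* n ℕ.* 1         ≤⟨ ℤ.drop‿+≤+ (subst₂ ℤ._≤_ (sym (ℤ.pos-* (suc k ℕ.* n) 1)) (sym (ℤ.pos-* m (suc d ℕ.* 1))) cross′) ⟩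
    m ℕ.* (suc d ℕ.* 1)       ≡⟨ ℕ.*-comm m _ ⟩
    suc d ℕ.* 1 ℕ.* m         ≡⟨ cong (ℕ._* m) (ℕ.*-identityʳ (suc d)) ⟩
    suc d ℕ.* m               ∎
    where
    open ℕ.≤-Reasoning
    cross : + suc k ℤ.* + n ℤ.* + 1 ℤ.≤ + m ℤ.* + (suc d ℕ.* 1)
    cross = ℚᵘ.drop-*≤* (toℚᵘ-*ℕ→ℚ-≤ (mkℚ (+ suc k) d coprime) n m le)
    cross′ : + (suc k ℕ.* n) ℤ.* + 1 ℤ.≤ + m ℤ.* + (suc d ℕ.* 1)
    cross′ = subst (λ x → x ℤ.* + 1 ℤ.≤ + m ℤ.* + (suc d ℕ.* 1)) (sym (ℤ.pos-* (suc k) n)) cross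

  1/suc : ℕ → ℚ
  1/suc k = mkℚ (+ 1) k (1-coprimeTo (suc k))

  r≤L*[1+k]⇒1/[1+k]*r≤L : ∀ k r L → r ℕ.≤ L ℕ.* suc k → 1/suc k ℚ.* ℕ→ℚ r ℚ.≤ ℕ→ℚ L
  r≤L*[1+k]⇒1/[1+k]*r≤L k r L le = fromℚᵘ-*ℕ→ℚ-≤ (1/suc k) r L (*≤* (subst₂ ℤ._≤_ lhs rhs (ℤ.+≤+ le)))
    where
    lhs : + r ≡ + 1 ℤ.* + r ℤ.* + 1
    lhs = sym (trans (ℤ.*-identityʳ (+ 1 ℤ.* + r)) (ℤ.*-identityˡ (+ r)))
    rhs : + (L ℕ.* suc k) ≡ + L ℤ.* + (suc k ℕ.* 1)
    rhs = trans (ℤ.pos-* L (suc k)) (cong (λ x → + L ℤ.* + x) (sym (ℕ.*-identityʳ (suc k))))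

module PairStar where

  open import Data.Bool using (Bool; _∧_; _xor_)
  open import Data.Nat
  open import Data.Nat.Properties
  open import Data.Nat.DivMod using (m/n*n≤m; m≡m%n+[m/n]*n; m%n<n; m/n<m)
  open import Data.Nat.Tactic.RingSolver using (solve-∀; solve)
  open import Algebra.Properties.CommutativeSemigroup *-commutativeSemigroup using (x∙yz≈y∙xz)
  open import Data.Fin using (Fin; zero; suc)
  import Data.Fin.Properties as Fin
  open import Data.Vec using (Vec; lookup)
  open import Data.List using (List; []; _∷_; map; _++_; length; filter; allFin; take; drop; deduplicate)
  open import Data.List.Properties using (map-++; map-cong; take++drop≡id; length-map; length-take; length-tabulate)
  open import Data.List.Relation.Unary.All using (universal-U)
  open import Data.List.Relation.Unary.Unique.Propositional.Properties using (allFin⁺; take⁺)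
  open import Data.Product using (_,_; proj₁; proj₂)
  open import Function using (_∘_; id)
  open import Relation.Nullary using (¬_; Dec; ¬?)
  open import Relation.Binary.PropositionalEquality
  open import Data.Integer as ℤ using (ℤ; +_; ∣_∣)
  import Data.Integer.Properties as ℤ
  import Data.Integer.Tactic.RingSolver as ℤ-Solver
  open import Data.Rational as ℚ using (ℚ; Positive)
  open import Defs
  open Counting
  open RandomSigns
  open Concentration
  open Distinct
  open Rationals

  -- δ = 1 / (48 ↧ε)
  δ : ℚ → ℚ
  δ ε = 1/suc (pred (48 * ℚ.↧ₙ ε))

  trivial-star-goodCount : ∀ ε {n₁ n} (E : BipGraph n₁ n) (x : Fin 1 → Fin n₁) →
    3 * 2 ^ n ≤ 4 * goodCount E (δ ε) 0 0 x
  trivial-star-goodCount ε {n = n} E x = begin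
    3 * 2 ^ n                    ≤⟨ *-monoˡ-≤ (2 ^ n) (n≤1+n 3) ⟩
    4 * 2 ^ n                    ≡⟨ cong (4 *_) all-good ⟨
    4 * goodCount E (δ ε) 0 0 x  ∎
    where
    open ≤-Reasoning
    good? : ∀ W → Dec (δ ε ℚ.* ℕ→ℚ 0 ℚ.≤ ℕ→ℚ (length (AW E W 0 0 x)))
    good? W = δ ε ℚ.* ℕ→ℚ 0 ℚ.≤? ℕ→ℚ (length (AW E W 0 0 x))
    all-good : goodCount E (δ ε) 0 0 x ≡ 2 ^ n
    all-good = trans (length-filter≡sumOver-𝟙 good? (allSubsets n))
      (trans (sumOver-cong (allSubsets n) (λ W → 𝟙-yes (good? W) (r≤L*[1+k]⇒1/[1+k]*r≤L (pred (48 * ℚ.↧ₙ ε)) 0 (length (AW E W 0 0 x)) z≤n)))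
             (trans (sumSubsets-const n 1) (*-identityʳ (2 ^ n))))

  -- 49 (out) and 48 (collisions) are chosen so that E[bad] ≤ (4/49 + 1/48) t < (t + 1) / 8.
  private
    markov-arithmetic : ∀ t X A B k → 49 * A ≤ t * (4 * X) → 48 * B ≤ t * X → suc t * k ≤ 2 * (A + B) → 4 * k ≤ X
    markov-arithmetic t X A B k ΣA ΣB markov = *-cancelʳ-≤ (4 * k) X (294 * suc t) (begin
      4 * k * (294 * suc t)                   ≡⟨ solve (t ∷ k ∷ []) ⟩
      1176 * (suc t * k)                      ≤⟨ *-monoʳ-≤ 1176 markov ⟩
      1176 * (2 * (A + B))                    ≡⟨ solve (A ∷ B ∷ []) ⟩
      48 * (49 * A) + 49 * (48 * B)           ≤⟨ +-mono-≤ (*-monoʳ-≤ 48 ΣA) (*-monoʳ-≤ 49 ΣB) ⟩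
      48 * (t * (4 * X)) + 49 * (t * X)       ≡⟨ solve (t ∷ X ∷ []) ⟩
      241 * (t * X)                           ≤⟨ m≤m+n _ (53 * (t * X) + 294 * X) ⟩
      241 * (t * X) + (53 * (t * X) + 294 * X) ≡⟨ solve (t ∷ X ∷ []) ⟩
      X * (294 * suc t)                       ∎)
      where open ≤-Reasoning

  module _ (ε : ℚ) (ε>0 : Positive ε) {n₁ n : ℕ} (E : BipGraph n₁ n) (r′ : ℕ)
           (x : Fin (suc (suc r′)) → Fin n₁)
           (r²≤n : suc r′ * suc r′ ≤ n) (n<[r+1]² : n < suc (suc r′) * suc (suc r′))
           (star : IsPairStar E ε (suc r′) (suc r′) x) where

    private
      r s M t : ℕ
      r = suc r′
      s = ℚ.↧ₙ ε
      M = 24 * s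
      t = suc (r / M)

      I : List (Fin r)
      I = take t (allFin r)

      N : Fin (suc r) → Fin n → Bool
      N i = E (x i)

      g : Vec Bool n → Fin r → ℤ
      g W i = hitsDiff (N (suc i)) (N zero) W

      inRange? : (v : ℤ) → Dec (∣ v ∣ ≤ 3 * r)
      inRange? v = ∣ v ∣ ≤? 3 * r

      L out col bad : Vec Bool n → ℕ
      L W = length (AW E W r r x)
      out W = length (filter (¬? ∘ inRange?) (map (g W) I))
      col W = collisions ℤ._≟_ (map (g W) I)
      bad W = out W + col W

      good? : ∀ W → Dec (δ ε ℚ.* ℕ→ℚ r ℚ.≤ ℕ→ℚ (L W))
      good? W = δ ε ℚ.* ℕ→ℚ r ℚ.≤? ℕ→ℚ (L W)

      r<t*M : r < t * M
      r<t*M = begin-strict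
        r                  ≡⟨ m≡m%n+[m/n]*n r M ⟩
        r % M + r / M * M  <⟨ +-monoˡ-< (r / M * M) (m%n<n r M) ⟩
        t * M              ∎
        where open ≤-Reasoning

      length-I : length I ≡ t
      length-I = trans (length-take t (allFin r)) (trans (cong (t ⊓_) (length-tabulate id))
                       (m≤n⇒m⊓n≡m (m/n<m r M (≤-trans (s≤s (s≤s z≤n)) (*-monoʳ-≤ 24 (s≤s z≤n))))))

      AW≡ : ∀ W → AW E W r r x ≡ deduplicate ℤ._≟_ (filter inRange? (map (g W) (allFin r)))
      AW≡ W = cong (deduplicate ℤ._≟_ ∘ filter inRange?)
        (map-cong (λ i → cong₂ (λ u v → + u ℤ.- + v) (countB≡count (λ k → N (suc i) k ∧ lookup W k))
                                                         (countB≡count (λ k → N zero k ∧ lookup W k))) (allFin r))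

      t≤L+bad : ∀ W → t ≤ L W + bad W
      t≤L+bad W = subst₂ _≤_ (trans (length-map (g W) I) length-I) lhs≡
        (length≤distinct-in-range+out-of-range+collisions ℤ._≟_ inRange? (map (g W) I) (map (g W) (drop t (allFin r))))
        where
        lhs≡ : length (deduplicate ℤ._≟_ (filter inRange? (map (g W) I ++ map (g W) (drop t (allFin r))))) + out W + col W
             ≡ L W + bad W
        lhs≡ = trans (cong (λ ys → length (deduplicate ℤ._≟_ (filter inRange? ys)) + out W + col W)
                           (trans (sym (map-++ (g W) I _)) (cong (map (g W)) (take++drop≡id t (allFin r)))))
                     (trans (cong (λ A → length A + out W + col W) (sym (AW≡ W))) (+-assoc (L W) (out W) (col W)))

      few-bad⇒good : ∀ W → 2 * bad W ≤ t → δ ε ℚ.* ℕ→ℚ r ℚ.≤ ℕ→ℚ (L W)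
      few-bad⇒good W 2bad≤t = r≤L*[1+k]⇒1/[1+k]*r≤L (pred (48 * s)) r (L W) (begin
        r                  ≤⟨ <⇒≤ r<t*M ⟩
        t * M              ≤⟨ *-monoˡ-≤ M t≤2L ⟩
        2 * L W * M        ≡⟨ constants (L W) s ⟩
        L W * (48 * s)     ∎)
        where
        open ≤-Reasoning
        constants : ∀ l s → 2 * l * (24 * s) ≡ l * (48 * s)
        constants = solve-∀
        t≤2L : t ≤ 2 * L W
        t≤2L = +-cancelʳ-≤ t t (2 * L W) (begin
          t + t                          ≤⟨ +-mono-≤ (t≤L+bad W) (t≤L+bad W) ⟩
          (L W + bad W) + (L W + bad W)  ≡⟨ double (L W) (bad W) ⟩
          2 * L W + 2 * bad W            ≤⟨ +-monoʳ-≤ (2 * L W) 2bad≤t ⟩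
          2 * L W + t                    ∎)
          where
          double : ∀ l b → (l + b) + (l + b) ≡ 2 * l + 2 * b
          double = solve-∀

      suc[t]*𝟙[bad]≤2*bad : ∀ W → suc t * 𝟙 (¬? (good? W)) ≤ 2 * bad W
      suc[t]*𝟙[bad]≤2*bad W = *𝟙-≤ (suc t) (¬? (good? W)) (λ ¬good → ≰⇒> (λ few → ¬good (few-bad⇒good W few)))

      Σout : 49 * sumSubsets n out ≤ t * (4 * 2 ^ n)
      Σout = begin
        49 * sumSubsets n out                    ≡⟨ cong (49 *_) Σout≡ ⟩
        49 * sumOver I (λ i → sumSubsets n (farᵢ i)) ≤⟨ *-sumOver-≤ 49 (4 * 2 ^ n) I (λ i → sumSubsets n (farᵢ i)) (universal-U I) (λ i _ → far-leaf i) ⟩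
        length I * (4 * 2 ^ n)                   ≡⟨ cong (_* (4 * 2 ^ n)) length-I ⟩
        t * (4 * 2 ^ n)                          ∎
        where
        open ≤-Reasoning
        farᵢ : Fin r → Vec Bool n → ℕ
        farᵢ i W = 𝟙 (¬? (inRange? (g W i)))
        Σout≡ : sumSubsets n out ≡ sumOver I (λ i → sumSubsets n (farᵢ i))
        Σout≡ = trans (sumOver-cong (allSubsets n) (λ W → trans (length-filter≡sumOver-𝟙 (¬? ∘ inRange?) (map (g W) I))
                                                               (sumOver-map (g W) I _)))
                      (sumOver-swap (allSubsets n) I (λ W i → farᵢ i W))
        far-leaf : ∀ i → 49 * sumSubsets n (farᵢ i) ≤ 4 * 2 ^ n
        far-leaf i = large-deviation n (N (suc i)) (N zero) r (s≤s z≤n) n<[r+1]²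
          (subst₂ (λ u v → u ≤ v + r) (countB≡count (N (suc i))) (countB≡count (N zero)) (proj₁ (proj₁ (proj₂ star) i)))
          (subst₂ (λ u v → u ≤ v + r) (countB≡count (N zero)) (countB≡count (N (suc i))) (proj₂ (proj₁ (proj₂ star) i)))

      -- Distinct leaves differ on ≥ εn ≥ r²/↧ε vertices, so they collide with probability ≤ ↧ε / r.
      collision : ∀ i j → ¬ i ≡ j → r * sumSubsets n (λ W → 𝟙 (g W i ℤ.≟ g W j)) ≤ s * 2 ^ n
      collision i j i≢j = begin
        r * sumSubsets n (λ W → 𝟙 (g W i ℤ.≟ g W j))   ≡⟨ cong (r *_) same-level ⟩
        r * levelCount n a b (+ 0)                     ≡⟨ *-comm r _ ⟩
        levelCount n a b (+ 0) * r                     ≤⟨ anticoncentration n a b (+ 0) r s r²≤n n≤s*m ⟩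
        s * 2 ^ n                                      ∎
        where
        open ≤-Reasoning
        a = N (suc i)
        b = N (suc j)
        n≤s*m : n ≤ s * symDiff a b
        n≤s*m = subst (λ m → n ≤ s * m) (countB≡count (λ k → a k xor b k))
          (ε*n≤m⇒n≤↧ε*m ε n _ ε>0 (proj₂ (proj₂ star) (suc i) (suc j) (i≢j ∘ Fin.suc-injective)))
        difference : ∀ u v w → (u ℤ.- w) ℤ.- (v ℤ.- w) ≡ u ℤ.- v
        difference = ℤ-Solver.solve-∀
        same-level : sumSubsets n (λ W → 𝟙 (g W i ℤ.≟ g W j)) ≡ levelCount n a b (+ 0)
        same-level = sumOver-cong (allSubsets n) λ W →
          let gᵢ-gⱼ≡ = difference (+ hits a W) (+ hits b W) (+ hits (N zero) W) in
          𝟙-cong (g W i ℤ.≟ g W j) (hitsDiff a b W ℤ.≟ + 0)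
            (λ eq → trans (sym gᵢ-gⱼ≡) (ℤ.i≡j⇒i-j≡0 eq))
            (λ eq → ℤ.i-j≡0⇒i≡j (g W i) (g W j) (trans gᵢ-gⱼ≡ eq))

      Σcol : 48 * sumSubsets n col ≤ t * 2 ^ n
      Σcol = *-cancelˡ-≤ r (begin
        r * (48 * sumSubsets n col)             ≡⟨ x∙yz≈y∙xz r 48 (sumSubsets n col) ⟩
        48 * (r * sumSubsets n col)             ≡⟨ cong (λ c → 48 * (r * c)) Σcol≡ ⟩
        48 * (r * sumPairs I F)                 ≤⟨ *-monoʳ-≤ 48 (*-sumPairs-≤ r (s * 2 ^ n) I F (take⁺ t (allFin⁺ r)) collision) ⟩
        48 * (pairCount I * (s * 2 ^ n))        ≡⟨ regroup (pairCount I) s (2 ^ n) ⟩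
        2 * pairCount I * (24 * s) * 2 ^ n      ≡⟨ cong (λ p → p * M * 2 ^ n) 2*pairCount≡ ⟩
        t * (r / M) * M * 2 ^ n                 ≡⟨ cong (_* 2 ^ n) (*-assoc t (r / M) M) ⟩
        t * (r / M * M) * 2 ^ n                 ≤⟨ *-monoˡ-≤ (2 ^ n) (*-monoʳ-≤ t (m/n*n≤m r M)) ⟩
        t * r * 2 ^ n                           ≡⟨ trans (cong (_* 2 ^ n) (*-comm t r)) (*-assoc r t (2 ^ n)) ⟩
        r * (t * 2 ^ n)                         ∎)
        where
        open ≤-Reasoning
        F : Fin r → Fin r → ℕ
        F i j = sumSubsets n (λ W → 𝟙 (g W i ℤ.≟ g W j))
        Σcol≡ : sumSubsets n col ≡ sumPairs I F
        Σcol≡ = trans (sumOver-cong (allSubsets n) (λ W → sumPairs-map (g W) I (λ u v → 𝟙 (u ℤ.≟ v))))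
                      (sumOver-sumPairs (allSubsets n) I (λ W i j → 𝟙 (g W i ℤ.≟ g W j)))
        2*pairCount≡ : 2 * pairCount I ≡ t * (r / M)
        2*pairCount≡ = +-cancelʳ-≡ t _ _ (begin-equality
          2 * pairCount I + t              ≡⟨ cong (λ l → 2 * pairCount I + l) length-I ⟨
          2 * pairCount I + length I       ≡⟨ 2*pairCount+length≡length² I ⟩
          length I * length I              ≡⟨ cong (λ l → l * l) length-I ⟩
          t * t                            ≡⟨ trans (*-suc t (r / M)) (+-comm t _) ⟩
          t * (r / M) + t                  ∎)
        regroup : ∀ p s X → 48 * (p * (s * X)) ≡ 2 * p * (24 * s) * X
        regroup = solve-∀

      #bad : ℕ
      #bad = sumSubsets n (λ W → 𝟙 (¬? (good? W)))

      markov : suc t * #bad ≤ 2 * (sumSubsets n out + sumSubsets n col)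
      markov = begin
        suc t * #bad                                 ≡⟨ sumOver-* (allSubsets n) (suc t) _ ⟨
        sumSubsets n (λ W → suc t * 𝟙 (¬? (good? W))) ≤⟨ sumOver-mono (allSubsets n) suc[t]*𝟙[bad]≤2*bad ⟩
        sumSubsets n (λ W → 2 * bad W)               ≡⟨ sumOver-* (allSubsets n) 2 bad ⟩
        2 * sumSubsets n bad                         ≡⟨ cong (2 *_) (sumOver-+ (allSubsets n) out col) ⟩
        2 * (sumSubsets n out + sumSubsets n col)    ∎
        where open ≤-Reasoning

    pairStar-goodCount : 3 * 2 ^ n ≤ 4 * goodCount E (δ ε) (suc r′) (suc r′) x
    pairStar-goodCount = +-cancelʳ-≤ (4 * #bad) _ _ (begin
      3 * 2 ^ n + 4 * #bad          ≤⟨ +-monoʳ-≤ (3 * 2 ^ n) (markov-arithmetic t (2 ^ n) (sumSubsets n out) (sumSubsets n col) #bad Σout Σcol markov) ⟩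
      3 * 2 ^ n + 2 ^ n             ≡⟨ +-comm (3 * 2 ^ n) (2 ^ n) ⟩
      4 * 2 ^ n                     ≡⟨ cong (4 *_) good+bad ⟨
      4 * (#good + #bad)            ≡⟨ *-distribˡ-+ 4 #good #bad ⟩
      4 * #good + 4 * #bad          ≡⟨ cong (λ G → 4 * G + 4 * #bad) (length-filter≡sumOver-𝟙 good? (allSubsets n)) ⟨
      4 * goodCount E (δ ε) r r x + 4 * #bad ∎)
      where
      open ≤-Reasoning
      #good = sumSubsets n (𝟙 ∘ good?)
      good+bad : #good + #bad ≡ 2 ^ n
      good+bad = trans (sym (sumOver-+ (allSubsets n) (𝟙 ∘ good?) (λ W → 𝟙 (¬? (good? W)))))
        (trans (sumOver-cong (allSubsets n) (𝟙+𝟙¬ ∘ good?)) (trans (sumSubsets-const n 1) (*-identityʳ (2 ^ n))))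

open import Defs
open import Data.Nat using (ℕ; zero; suc; _*_; _≤_; _<_; _^_)
open import Data.Fin using (Fin)
open import Data.Product using (Σ; _×_; _,_)
open import Data.Rational using (ℚ; Positive)
open PairStar

lemma3p3 : (ε : ℚ) → Positive ε →
    Σ ℚ (λ δ → Positive δ ×
    ((n₁ n₂ : ℕ) (E : BipGraph n₁ n₂) (r : ℕ) →
    r * r ≤ n₂ → n₂ < suc r * suc r →
    n₂ ≤ 2 * n₁ →
    (x : Fin (suc r) → Fin n₁) → IsPairStar E ε r r x →
    3 * 2 ^ n₂ ≤ 4 * goodCount E δ r r x))
lemma3p3 ε ε>0 = δ ε , _ , λ where
  n₁ n₂ E zero _ _ _ x _ → trivial-star-goodCount ε E x
  n₁ n₂ E (suc r′) r²≤n₂ n₂<[r+1]² _ x star → pairStar-goodCount ε ε>0 E r′ x r²≤n₂ n₂<[r+1]² star
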